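{- Let $a,b$ be positive integers and let $n$ be a positive integer with $n\ge \frac{2b}{a}$. Then \[\left\lfloor \frac{b+\sqrt{4n+1}}{a}\right\rfloor=\left\lfloor \frac{b+\sqrt{4n+2}}{a}\right\rfloor=\left\lfloor \frac{b+\sqrt{4n+3}}{a}\right\rfloor .\]
   Context: $\lfloor y\rfloor$ denotes the greatest integer less than or equal to $y$. -}

module Defs where

open import Data.Nat using (ℕ)
open import Data.Integer using (ℤ; +_; _+_; _-_; _*_; _≤_; _<_)
open import Data.Product using (_×_)
open import Data.Sum using (_⊎_)

-- No reals are available, so comparisons of an integer x with the real
-- number √m (m : ℕ) are encoded exactly by squaring:
--   x ≤ √m  iff  x ≤ 0  or  x² ≤ m
--   √m < x  iff  0 < x  and  m < x²
_≤√_ : ℤ → ℕ → Set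
x ≤√ m = (x ≤ + 0) ⊎ (x * x ≤ + m)

√_<_ : ℕ → ℤ → Set
√ m < x = (+ 0 < x) × (+ m < x * x)

-- IsFloor a b m k  :⇔  k = ⌊ (b + √m) / a ⌋   (for a > 0), i.e.
--   k ≤ (b + √m)/a < k + 1
--   ⇔ k·a - b ≤ √m < (k+1)·a - b.
IsFloor : ℕ → ℕ → ℕ → ℤ → Set
IsFloor a b m k = ((k * + a - + b) ≤√ m) × (√ m < ((k + + 1) * + a - + b))

{-# OPTIONS --safe #-}
module Submission where

open import Defs
open import Data.Nat using (ℕ; _+_; _*_; _≤_; _<_)
open import Data.Integer using (ℤ)
open import Data.Product using (_×_)
open import Function.Bundles using (_⇔_)

-- Since k·a − b is an integer, whether k ≤ (b + √m)/a < k + 1 depends only on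
-- which integers t satisfy t² ≤ m.  Squares are 0 or 1 modulo 4, so no square
-- equals 4n + 2 or 4n + 3, and these integers t are the same for m = 4n + 1,
-- 4n + 2 and 4n + 3.

open import Data.Nat using (suc; z≤n; s≤s)
open import Data.Nat.Properties
  using (≤-trans; ≤-refl; m≤n+m; +-monoʳ-≤; +-monoʳ-<; +-mono-≤; *-monoˡ-≤; *-cancelʳ-<; *-comm; +-comm;
         <⇒≱; ≰⇒>; module ≤-Reasoning)
open import Data.Nat.DivMod using (_%_; _/_; m≡m%n+[m/n]*n; m%n<n; %-distribˡ-*)
import Data.Integer as ℤ
open import Data.Integer.Properties using (+◃n≡+n; drop‿+≤+; drop‿+<+)
open import Data.Product using (_,_)
open import Data.Sum using (inj₁; inj₂)
open import Function.Bundles using (mk⇔; Equivalence)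
open import Function.Construct.Symmetry using (⇔-sym)
open import Function.Construct.Composition using (_⇔-∘_)
open import Relation.Binary.PropositionalEquality using (_≡_; sym; cong; subst)

square%4≤1 : ∀ t → (t * t) % 4 ≤ 1
square%4≤1 t = subst (_≤ 1) (sym (%-distribˡ-* t t 4)) (residue (t % 4) (m%n<n t 4))
  where
    residue : ∀ r → r < 4 → (r * r) % 4 ≤ 1
    residue 0 _ = z≤n
    residue 1 _ = ≤-refl
    residue 2 _ = z≤n
    residue 3 _ = ≤-refl
    residue (suc (suc (suc (suc _)))) (s≤s (s≤s (s≤s (s≤s ()))))

%4≤1∧≤4n+3⇒≤4n+1 : ∀ m n → m % 4 ≤ 1 → m ≤ 4 * n + 3 → m ≤ 4 * n + 1
%4≤1∧≤4n+3⇒≤4n+1 m n m%4≤1 m≤4n+3 = begin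
  m                 ≡⟨ m≡m%n+[m/n]*n m 4 ⟩
  m % 4 + m / 4 * 4 ≤⟨ +-mono-≤ m%4≤1 (*-monoˡ-≤ 4 m/4≤n) ⟩
  1 + n * 4         ≡⟨ +-comm 1 (n * 4) ⟩
  n * 4 + 1         ≡⟨ cong (_+ 1) (*-comm n 4) ⟩
  4 * n + 1         ∎
  where
    open ≤-Reasoning
    m/4*4<[1+n]*4 : m / 4 * 4 < suc n * 4
    m/4*4<[1+n]*4 = begin-strict
      m / 4 * 4         ≤⟨ m≤n+m (m / 4 * 4) (m % 4) ⟩
      m % 4 + m / 4 * 4 ≡⟨ sym (m≡m%n+[m/n]*n m 4) ⟩
      m                 ≤⟨ m≤4n+3 ⟩
      4 * n + 3         <⟨ +-monoʳ-< (4 * n) ≤-refl ⟩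
      4 * n + 4         ≡⟨ +-comm (4 * n) 4 ⟩
      4 + 4 * n         ≡⟨ cong (4 +_) (*-comm 4 n) ⟩
      suc n * 4         ∎
    m/4≤n : m / 4 ≤ n
    m/4≤n with *-cancelʳ-< 4 (m / 4) (suc n) m/4*4<[1+n]*4
    ... | s≤s m/4≤n = m/4≤n

square≤4n+1⇔square≤4n+r : ∀ n r t → 1 ≤ r → r ≤ 3 → (t * t ≤ 4 * n + 1 ⇔ t * t ≤ 4 * n + r)
square≤4n+1⇔square≤4n+r n r t 1≤r r≤3 = mk⇔
  (λ t²≤4n+1 → ≤-trans t²≤4n+1 (+-monoʳ-≤ (4 * n) 1≤r))
  (λ t²≤4n+r → %4≤1∧≤4n+3⇒≤4n+1 (t * t) n (square%4≤1 t) (≤-trans t²≤4n+r (+-monoʳ-≤ (4 * n) r≤3)))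

i*i≡+∣i∣*∣i∣ : ∀ i → i ℤ.* i ≡ ℤ.+ (ℤ.∣ i ∣ * ℤ.∣ i ∣)
i*i≡+∣i∣*∣i∣ (ℤ.+ n)    = +◃n≡+n (n * n)
i*i≡+∣i∣*∣i∣ ℤ.-[1+ n ] = +◃n≡+n (suc n * suc n)

module _ {m m′ : ℕ} (sameSquares : ∀ t → t * t ≤ m ⇔ t * t ≤ m′) where

  ≤√-transport : ∀ x → x ≤√ m → x ≤√ m′
  ≤√-transport x (inj₁ x≤0)  = inj₁ x≤0
  ≤√-transport x (inj₂ x²≤m) rewrite i*i≡+∣i∣*∣i∣ x =
    inj₂ (ℤ.+≤+ (Equivalence.to (sameSquares ℤ.∣ x ∣) (drop‿+≤+ x²≤m)))

  √<-transport : ∀ y → √ m < y → √ m′ < y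
  √<-transport y (0<y , m<y²) rewrite i*i≡+∣i∣*∣i∣ y =
    0<y , ℤ.+<+ (≰⇒> λ y²≤m′ → <⇒≱ (drop‿+<+ m<y²) (Equivalence.from (sameSquares ℤ.∣ y ∣) y²≤m′))

  IsFloor-transport : ∀ a b k → IsFloor a b m k → IsFloor a b m′ k
  IsFloor-transport a b k (lower , upper) = ≤√-transport _ lower , √<-transport _ upper

IsFloor-cong : ∀ {m m′} → (∀ t → t * t ≤ m ⇔ t * t ≤ m′) → ∀ a b k → IsFloor a b m k ⇔ IsFloor a b m′ k
IsFloor-cong sameSquares a b k =
  mk⇔ (IsFloor-transport sameSquares a b k) (IsFloor-transport (λ t → ⇔-sym (sameSquares t)) a b k)

corollary7 : (a b n : ℕ) → 0 < a → 0 < b → 0 < n → 2 * b ≤ n * a →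
    (k : ℤ) →
      (IsFloor a b (4 * n + 1) k ⇔ IsFloor a b (4 * n + 2) k)
      × (IsFloor a b (4 * n + 2) k ⇔ IsFloor a b (4 * n + 3) k)
corollary7 a b n _ _ _ _ k =
  IsFloor-cong 4n+1~4n+2 a b k , IsFloor-cong (λ t → 4n+1~4n+3 t ⇔-∘ ⇔-sym (4n+1~4n+2 t)) a b k
  where
    4n+1~4n+2 : ∀ t → t * t ≤ 4 * n + 1 ⇔ t * t ≤ 4 * n + 2
    4n+1~4n+2 t = square≤4n+1⇔square≤4n+r n 2 t (s≤s z≤n) (s≤s (s≤s z≤n))
    4n+1~4n+3 : ∀ t → t * t ≤ 4 * n + 1 ⇔ t * t ≤ 4 * n + 3
    4n+1~4n+3 t = square≤4n+1⇔square≤4n+r n 3 t (s≤s z≤n) ≤-refl
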